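{- For every positive integer $n$ and every partition $\alpha\in\mathcal{P}(n)$ there exist unique integers $q>0$ and $s_1,\dots,s_q\ge0$ such that \[ \delta(\alpha)=\big(1,2,\dots,q-1,q,q^{(s_q)},(q-1)^{(s_{q-1})},\dots,1^{(s_1)}\big), \] and these satisfy $\frac{q(q+1)}{2}+\sum_{k=1}^q k\,s_k=n$.
   Context: $\mathcal{P}(n)$ is the set of partitions $\alpha=(\alpha_1\ge\dots\ge\alpha_t\ge1)$ of $n$, with $\alpha_i=0$ for $i>t$. The diagonal sequence is $\delta(\alpha)=(d_k)_{k\ge1}$ with $d_k=\big|\{i:1\le i\le k,\ \alpha_i+i-1\ge k\}\big|$, trailing zeros omitted. The notation $m^{(s)}$ means $s$ consecutive entries equal to $m$ (none if $s=0$). -}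

module Defs where

open import Data.Nat using (ℕ; zero; suc; _+_; _*_; _∸_; _≤_; _≥_; _≤?_; _<?_)
open import Data.Nat.ListAction using (sum)
open import Data.Product using (_×_)
open import Relation.Nullary using (yes; no)
open import Data.List using (List; []; _∷_; length; filter; map; upTo; downFrom; replicate; allFin; concat; _++_; reverse; dropWhile)
open import Data.List.Relation.Unary.Linked using (Linked)
open import Data.List.Relation.Unary.All using (All)
open import Data.Vec using (Vec; lookup)
open import Data.Fin using (Fin; toℕ; fromℕ<)
open import Relation.Binary.PropositionalEquality using (_≡_)
open import Relation.Nullary.Decidable using (does)
open import Data.Nat using (_≟_)

IsPartition : ℕ → List ℕ → Set
IsPartition n α = Linked _≥_ α × All (λ a → 1 ≤ a) α × (sum α ≡ n)

-- α_i (1-indexed), with α_i = 0 for i > t (and for i = 0, unused).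
part : List ℕ → ℕ → ℕ
part [] i = 0
part (a ∷ α) zero = 0
part (a ∷ α) (suc zero) = a
part (a ∷ α) (suc (suc i)) = part α (suc i)

oneTo : ℕ → List ℕ
oneTo k = map suc (upTo k)

diag : List ℕ → ℕ → ℕ
diag α k = length (filter (λ i → k ≤? part α i + i ∸ 1) (oneTo k))

dropTrailingZeros : List ℕ → List ℕ
dropTrailingZeros xs = reverse (dropWhile (λ x → x ≟ 0) (reverse xs))

-- Since α_i + i - 1 ≤ n
-- for every i ≤ t (and α_i = 0 for i > t), d_k = 0 for all k > n = sum α,
-- so it suffices to list d_1, …, d_n and then drop trailing zeros.
δ : List ℕ → List ℕ
δ α = dropTrailingZeros (map (diag α) (oneTo (sum α)))

-- s_k for 1 ≤ k ≤ q, where s : Vec ℕ q stores s_{j+1} at index j.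
sAt : {q : ℕ} → Vec ℕ q → Fin q → ℕ
sAt s j = lookup s j

pattern-seq : (q : ℕ) → Vec ℕ q → List ℕ
pattern-seq q s = oneTo q ++ concat (map blk (downFrom q))
  where
  blk : ℕ → List ℕ
  blk j with j <? q
  ... | yes j<q = replicate (lookup s (fromℕ< j<q)) (suc j)
  ... | no _ = []

weightedSum : (q : ℕ) → Vec ℕ q → ℕ
weightedSum q s = sum (map (λ (j : Fin q) → suc (toℕ j) * lookup s j) (allFin q))

-- Write h j = α_{j+1} + j for the rows of α counted from 0, so that d_k = #{j < k : k ≤ h j}; as α is
-- nonincreasing, h (j + 1) ≤ h j + 1. Call k saturated when every row j < k reaches k, i.e. d_k = k.
-- Saturation is downward closed, holds at 1 and fails at n + 1; let q be the largest saturated k.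
-- Then d_k = k for k ≤ q, and d_{k+1} ≤ d_k for k ≥ q: if some row j ≤ k misses k + 1, the last such
-- row ends exactly at k, which balances the new row k. Hence δ(α) is 1, …, q followed by a
-- nonincreasing sequence with entries in [1, q], that is, by the blocks q^(s_q) … 1^(s_1) where s_j is
-- the multiplicity of j. So q is the largest entry of δ(α) and the s_j are multiplicities, which gives
-- uniqueness. Counting the pairs j < k ≤ h j row by row gives d_1 + ⋯ + d_n = α_1 + ⋯ + α_t = n,
-- while summing the pattern gives q(q+1)/2 + Σ k s_k.

module Submission where

open import Defs
open import Algebra.Properties.CommutativeSemigroup using (interchange)
open import Data.Empty using (⊥-elim)
open import Data.Fin using (toℕ; fromℕ<)
open import Data.Fin.Properties using (toℕ<n; toℕ-fromℕ<; fromℕ<-toℕ)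
open import Data.List using (List; []; _∷_; _++_; [_]; length; filter; map; upTo; applyUpTo; downFrom; replicate; concat; reverse; dropWhile; allFin; tabulate)
open import Data.List.Properties using (applyUpTo-∷ʳ; map-upTo; map-∘; map-cong; map-tabulate; tabulate-cong; length-++; length-replicate; filter-++; filter-all; filter-none; ++-assoc; ++-cancelˡ; reverse-++; reverse-involutive)
open import Data.List.Extrema.Nat using (max; max≤v⁺; v≤max⁺)
open import Data.List.Relation.Binary.Permutation.Propositional using (↭-sym)
open import Data.List.Relation.Binary.Permutation.Propositional.Properties using (All-resp-↭; ↭-reverse)
open import Data.List.Relation.Unary.All as All using (All; []; _∷_)
import Data.List.Relation.Unary.All.Properties as Allₚ
open import Data.List.Relation.Unary.Any using (Any)
import Data.List.Relation.Unary.Any.Properties as Any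
open import Data.List.Relation.Unary.Linked as Linked using (Linked; []; _∷_)
open import Data.List.Relation.Unary.Linked.Properties as Linkedₚ using (Linked⇒All)
open import Data.Nat using (ℕ; zero; suc; _+_; _*_; _∸_; _/_; _⊓_; _<_; _≤_; _≥_; _≤?_; _<?_; _≟_; z≤n; s≤s; z<s; s<s)
open import Data.Nat.DivMod using (m*n/n≡m)
open import Data.Nat.ListAction using (sum)
open import Data.Nat.ListAction.Properties using (sum-++; sum-↭)
open import Data.Nat.Properties
open import Data.Nat.Tactic.RingSolver using (solve-∀)
open import Data.Product using (Σ; ∃₂; ∃-syntax; _×_; _,_; proj₁; proj₂)
open import Data.Sum using (_⊎_; inj₁; inj₂)
open import Data.Vec using (Vec; lookup)
import Data.Vec as Vec
import Data.Vec.Properties as Vec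
open import Function using (_∘_; flip)
open import Relation.Nullary using (Dec; yes; no; ¬_; contradiction)
open import Relation.Unary using (Decidable)
open import Relation.Binary.PropositionalEquality using (_≡_; _≢_; refl; sym; trans; cong; cong₂; subst; subst₂; module ≡-Reasoning)
open ≡-Reasoning

𝟙 : ∀ {p} {P : Set p} → Dec P → ℕ
𝟙 (yes _) = 1
𝟙 (no _)  = 0

𝟙-mono : ∀ {p q} {P : Set p} {Q : Set q} (P? : Dec P) (Q? : Dec Q) → (P → Q) → 𝟙 P? ≤ 𝟙 Q?
𝟙-mono (yes _) (yes _) _   = ≤-refl
𝟙-mono (yes p) (no ¬q) P⇒Q = contradiction (P⇒Q p) ¬q
𝟙-mono (no _)  _       _   = z≤n

𝟙-yes : ∀ {p} {P : Set p} (P? : Dec P) → P → 𝟙 P? ≡ 1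
𝟙-yes (yes _) _  = refl
𝟙-yes (no ¬p) p = contradiction p ¬p

𝟙-no : ∀ {p} {P : Set p} (P? : Dec P) → ¬ P → 𝟙 P? ≡ 0
𝟙-no (yes p) ¬p = contradiction p ¬p
𝟙-no (no _)  _  = refl

∑ : ℕ → (ℕ → ℕ) → ℕ
∑ m f = sum (applyUpTo f m)

syntax ∑ m (λ j → e) = ∑[ j < m ] e

∑-init-last : ∀ m (f : ℕ → ℕ) → ∑[ j < suc m ] f j ≡ ∑[ j < m ] f j + f m
∑-init-last m f = begin
  sum (applyUpTo f (suc m))         ≡⟨ cong sum (applyUpTo-∷ʳ f m) ⟨
  sum (applyUpTo f m ++ [ f m ])    ≡⟨ sum-++ (applyUpTo f m) [ f m ] ⟩
  ∑[ j < m ] f j + (f m + 0)        ≡⟨ cong (∑[ j < m ] f j +_) (+-identityʳ (f m)) ⟩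
  ∑[ j < m ] f j + f m              ∎

∑-cong : ∀ m {f g : ℕ → ℕ} → (∀ {j} → j < m → f j ≡ g j) → ∑[ j < m ] f j ≡ ∑[ j < m ] g j
∑-cong zero    f≡g = refl
∑-cong (suc m) f≡g = cong₂ _+_ (f≡g z<s) (∑-cong m (f≡g ∘ s<s))

∑-distrib-+ : ∀ m (f g : ℕ → ℕ) → ∑[ j < m ] (f j + g j) ≡ ∑[ j < m ] f j + ∑[ j < m ] g j
∑-distrib-+ zero    f g = refl
∑-distrib-+ (suc m) f g = begin
  f 0 + g 0 + ∑[ j < m ] (f (suc j) + g (suc j))                  ≡⟨ cong (f 0 + g 0 +_) (∑-distrib-+ m (f ∘ suc) (g ∘ suc)) ⟩
  f 0 + g 0 + (∑[ j < m ] f (suc j) + ∑[ j < m ] g (suc j))       ≡⟨ interchange +-commutativeSemigroup (f 0) (g 0) _ _ ⟩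
  f 0 + ∑[ j < m ] f (suc j) + (g 0 + ∑[ j < m ] g (suc j))       ∎

∑-mono : ∀ m {f g : ℕ → ℕ} → (∀ j → f j ≤ g j) → ∑[ j < m ] f j ≤ ∑[ j < m ] g j
∑-mono zero    f≤g = z≤n
∑-mono (suc m) f≤g = +-mono-≤ (f≤g 0) (∑-mono m (f≤g ∘ suc))

∑-one : ∀ m → ∑[ j < m ] 1 ≡ m
∑-one zero    = refl
∑-one (suc m) = cong suc (∑-one m)

length-filter≡sum-𝟙 : ∀ {p} {P : ℕ → Set p} (P? : Decidable P) xs → length (filter P? xs) ≡ sum (map (𝟙 ∘ P?) xs)
length-filter≡sum-𝟙 P? []       = refl
length-filter≡sum-𝟙 P? (x ∷ xs) with P? x
... | yes _ = cong suc (length-filter≡sum-𝟙 P? xs)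
... | no _  = length-filter≡sum-𝟙 P? xs

map-oneTo : ∀ {a} {A : Set a} (f : ℕ → A) m → map f (oneTo m) ≡ applyUpTo (f ∘ suc) m
map-oneTo f m = trans (sym (map-∘ (upTo m))) (map-upTo (f ∘ suc) m)

applyUpTo-+ : ∀ {a} {A : Set a} (f : ℕ → A) m n → applyUpTo f (m + n) ≡ applyUpTo f m ++ applyUpTo (λ j → f (m + j)) n
applyUpTo-+ f zero    n = refl
applyUpTo-+ f (suc m) n = cong (f 0 ∷_) (applyUpTo-+ (f ∘ suc) m n)

applyUpTo-cong : ∀ {a} {A : Set a} m {f g : ℕ → A} → (∀ {j} → j < m → f j ≡ g j) → applyUpTo f m ≡ applyUpTo g m
applyUpTo-cong zero    f≡g = refl
applyUpTo-cong (suc m) f≡g = cong₂ _∷_ (f≡g z<s) (applyUpTo-cong m (f≡g ∘ s<s))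

tabulate-toℕ : ∀ q (f : ℕ → ℕ) → tabulate {n = q} (f ∘ toℕ) ≡ applyUpTo f q
tabulate-toℕ zero    f = refl
tabulate-toℕ (suc q) f = cong (f 0 ∷_) (tabulate-toℕ q (f ∘ suc))

sum-replicate : ∀ c x → sum (replicate c x) ≡ c * x
sum-replicate zero    x = refl
sum-replicate (suc c) x = cong (x +_) (sum-replicate c x)

All-reverse : ∀ {a p} {A : Set a} {P : A → Set p} {xs} → All P xs → All P (reverse xs)
All-reverse {xs = xs} = All-resp-↭ (↭-sym (↭-reverse xs))

extend-< : ∀ {p} {P : ℕ → Set p} {m} → (∀ {j} → j < m → P j) → P m → ∀ {j} → j < suc m → P j
extend-< {m = m} P< Pm {j} j<1+m with j ≟ m
... | yes refl = Pm
... | no j≢m   = P< (≤∧≢⇒< (≤-pred j<1+m) j≢m)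

boundary : ∀ {p} {P : ℕ → Set p} → Decidable P → P 0 → ∀ n → ¬ P n → ∃[ q ] P q × ¬ P (suc q)
boundary P? P0 zero    ¬P0   = contradiction P0 ¬P0
boundary P? P0 (suc n) ¬P1+n with P? n
... | yes Pn = n , Pn , ¬P1+n
... | no ¬Pn = boundary P? P0 n ¬Pn

-- Nonincreasing lists as blocks

count : ℕ → List ℕ → ℕ
count x = length ∘ filter (x ≟_)

count-++ : ∀ x xs ys → count x (xs ++ ys) ≡ count x xs + count x ys
count-++ x xs ys = trans (cong length (filter-++ (x ≟_) xs ys)) (length-++ (filter (x ≟_) xs))

count-replicate : ∀ x c → count x (replicate c x) ≡ c
count-replicate x c = trans (cong length (filter-all (x ≟_) (Allₚ.replicate⁺ c refl))) (length-replicate c)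

count-absent : ∀ {x xs} → All (x ≢_) xs → count x xs ≡ 0
count-absent {x} x∉xs = cong length (filter-none (x ≟_) x∉xs)

count-replicate-++ : ∀ {x v} c ys → x ≢ v → count x (replicate c v ++ ys) ≡ count x ys
count-replicate-++ c ys x≢v = trans (count-++ _ (replicate c _) ys) (cong (_+ count _ ys) (count-absent (Allₚ.replicate⁺ c x≢v)))

blocks : (ℕ → ℕ) → ℕ → List ℕ
blocks f q = concat (map (λ j → replicate (f j) (suc j)) (downFrom q))

blocks-cong : ∀ q {f g : ℕ → ℕ} → (∀ {j} → j < q → f j ≡ g j) → blocks f q ≡ blocks g q
blocks-cong zero    f≡g = refl
blocks-cong (suc q) f≡g = cong₂ (λ c → replicate c (suc q) ++_) (f≡g ≤-refl) (blocks-cong q (f≡g ∘ m<n⇒m<1+n))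

blocks-≤ : ∀ f q → All (_≤ q) (blocks f q)
blocks-≤ f zero    = []
blocks-≤ f (suc q) = Allₚ.++⁺ (Allₚ.replicate⁺ (f q) ≤-refl) (All.map m≤n⇒m≤1+n (blocks-≤ f q))

blocks-positive : ∀ f q → All (1 ≤_) (blocks f q)
blocks-positive f zero    = []
blocks-positive f (suc q) = Allₚ.++⁺ (Allₚ.replicate⁺ (f q) (s≤s z≤n)) (blocks-positive f q)

count-blocks : ∀ f q {j} → j < q → count (suc j) (blocks f q) ≡ f j
count-blocks f (suc q) {j} j<1+q with j ≟ q
... | yes refl = begin
  count (suc j) (replicate (f j) (suc j) ++ blocks f j)          ≡⟨ count-++ (suc j) (replicate (f j) (suc j)) (blocks f j) ⟩
  count (suc j) (replicate (f j) (suc j)) + count (suc j) (blocks f j)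
    ≡⟨ cong₂ _+_ (count-replicate (suc j) (f j)) (count-absent (All.map (>⇒≢ ∘ s≤s) (blocks-≤ f j))) ⟩
  f j + 0                                                          ≡⟨ +-identityʳ (f j) ⟩
  f j                                                              ∎
... | no j≢q = trans (count-replicate-++ (f q) (blocks f q) (j≢q ∘ suc-injective)) (count-blocks f q (≤∧≢⇒< (≤-pred j<1+q) j≢q))

sum-blocks : ∀ f q → sum (blocks f q) ≡ ∑[ j < q ] (suc j * f j)
sum-blocks f zero    = refl
sum-blocks f (suc q) = begin
  sum (replicate (f q) (suc q) ++ blocks f q)           ≡⟨ sum-++ (replicate (f q) (suc q)) (blocks f q) ⟩
  sum (replicate (f q) (suc q)) + sum (blocks f q)      ≡⟨ cong₂ _+_ (trans (sum-replicate (f q) (suc q)) (*-comm (f q) (suc q))) (sum-blocks f q) ⟩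
  suc q * f q + ∑[ j < q ] (suc j * f j)                ≡⟨ +-comm (suc q * f q) _ ⟩
  ∑[ j < q ] (suc j * f j) + suc q * f q                ≡⟨ ∑-init-last q (λ j → suc j * f j) ⟨
  ∑[ j < suc q ] (suc j * f j)                          ∎

split-run : ∀ v {xs} → Linked _≥_ xs → All (_≤ v) xs →
  ∃₂ λ c ys → xs ≡ replicate c v ++ ys × Linked _≥_ ys × All (_< v) ys
split-run v {[]}     _  []            = 0 , [] , refl , [] , []
split-run v {x ∷ xs} lk (x≤v ∷ xs≤v) with x ≟ v
... | no x≢v = 0 , x ∷ xs , refl , lk , All.map (λ y≤x → ≤-<-trans y≤x x<v) (Linked⇒All (flip ≤-trans) ≤-refl lk)
  where
  x<v : x < v
  x<v = ≤∧≢⇒< x≤v x≢v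
... | yes refl with split-run v (Linked.tail lk) xs≤v
...   | c , ys , eq , lk′ , ys<v = suc c , ys , cong (v ∷_) eq , lk′ , ys<v

blocks-decomposition : ∀ q {xs} → Linked _≥_ xs → All (_≤ q) xs →
  xs ≡ blocks (λ j → count (suc j) xs) q ++ replicate (count 0 xs) 0
blocks-decomposition zero    {[]}     _  []            = refl
blocks-decomposition zero    {x ∷ xs} lk (z≤n ∷ xs≤0) = cong (0 ∷_) (blocks-decomposition zero (Linked.tail lk) xs≤0)
blocks-decomposition (suc q) lk xs≤q with split-run (suc q) lk xs≤q
... | c , ys , refl , lk′ , ys<q = begin
  run ++ ys
    ≡⟨ cong (run ++_) (blocks-decomposition q lk′ (All.map ≤-pred ys<q)) ⟩
  run ++ blocks (λ j → count (suc j) ys) q ++ replicate (count 0 ys) 0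
    ≡⟨ ++-assoc run _ _ ⟨
  (run ++ blocks (λ j → count (suc j) ys) q) ++ replicate (count 0 ys) 0
    ≡⟨ cong₂ _++_ (cong₂ _++_ (cong (λ c → replicate c (suc q)) (sym run-length)) (blocks-cong q (sym ∘ other-run)))
                  (cong (λ z → replicate z 0) (sym (count-replicate-++ c ys λ ()))) ⟩
  blocks (λ j → count (suc j) (run ++ ys)) (suc q) ++ replicate (count 0 (run ++ ys)) 0
    ∎
  where
  run : List ℕ
  run = replicate c (suc q)
  run-length : count (suc q) (run ++ ys) ≡ c
  run-length = begin
    count (suc q) (run ++ ys)               ≡⟨ count-++ (suc q) run ys ⟩
    count (suc q) run + count (suc q) ys    ≡⟨ cong₂ _+_ (count-replicate (suc q) c) (count-absent (All.map >⇒≢ ys<q)) ⟩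
    c + 0                                   ≡⟨ +-identityʳ c ⟩
    c                                       ∎
  other-run : ∀ {j} → j < q → count (suc j) (run ++ ys) ≡ count (suc j) ys
  other-run j<q = count-replicate-++ c ys (<⇒≢ j<q ∘ suc-injective)

dropWhile-zeros-++ : ∀ {xs} ys → All (_≡ 0) xs → dropWhile (_≟ 0) (xs ++ ys) ≡ dropWhile (_≟ 0) ys
dropWhile-zeros-++ ys []         = refl
dropWhile-zeros-++ ys (refl ∷ zs) = dropWhile-zeros-++ ys zs

dropWhile-positive : ∀ {xs} → All (1 ≤_) xs → dropWhile (_≟ 0) xs ≡ xs
dropWhile-positive []          = refl
dropWhile-positive (s≤s _ ∷ _) = refl

dropTrailingZeros-++-zeros : ∀ xs z → dropTrailingZeros (xs ++ replicate z 0) ≡ dropTrailingZeros xs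
dropTrailingZeros-++-zeros xs z = cong reverse (begin
  dropWhile (_≟ 0) (reverse (xs ++ replicate z 0))          ≡⟨ cong (dropWhile (_≟ 0)) (reverse-++ xs (replicate z 0)) ⟩
  dropWhile (_≟ 0) (reverse (replicate z 0) ++ reverse xs)  ≡⟨ dropWhile-zeros-++ (reverse xs) (All-reverse (Allₚ.replicate⁺ z refl)) ⟩
  dropWhile (_≟ 0) (reverse xs)                             ∎)

dropTrailingZeros-positive : ∀ {xs} → All (1 ≤_) xs → dropTrailingZeros xs ≡ xs
dropTrailingZeros-positive {xs} pos = trans (cong reverse (dropWhile-positive (All-reverse pos))) (reverse-involutive xs)

sum-dropWhile-zeros : ∀ xs → sum (dropWhile (_≟ 0) xs) ≡ sum xs
sum-dropWhile-zeros []           = refl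
sum-dropWhile-zeros (zero  ∷ xs) = sum-dropWhile-zeros xs
sum-dropWhile-zeros (suc _ ∷ _)  = refl

sum-dropTrailingZeros : ∀ xs → sum (dropTrailingZeros xs) ≡ sum xs
sum-dropTrailingZeros xs = begin
  sum (reverse (dropWhile (_≟ 0) (reverse xs)))  ≡⟨ sum-↭ (↭-reverse (dropWhile (_≟ 0) (reverse xs))) ⟩
  sum (dropWhile (_≟ 0) (reverse xs))            ≡⟨ sum-dropWhile-zeros (reverse xs) ⟩
  sum (reverse xs)                               ≡⟨ sum-↭ (↭-reverse xs) ⟩
  sum xs                                         ∎

-- mult s j is s_{j+1}; it is 0 for j ≥ q.
mult : ∀ {q} → Vec ℕ q → ℕ → ℕ
mult {q} s j with j <? q
... | yes j<q = lookup s (fromℕ< j<q)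
... | no _    = 0

-- The block function local to pattern-seq is not in scope; unification recovers it.
pattern-seq-unfold : ∀ q (s : Vec ℕ q) → Σ (ℕ → List ℕ) λ blk → pattern-seq q s ≡ oneTo q ++ concat (map blk (downFrom q))
pattern-seq-unfold q s = _ , refl

pattern-seq-blocks : ∀ {q} (s : Vec ℕ q) → pattern-seq q s ≡ oneTo q ++ blocks (mult s) q
pattern-seq-blocks {q} s = trans unfold (cong (λ bs → oneTo q ++ concat bs) (map-cong blk≗ (downFrom q)))
  where
  blk : ℕ → List ℕ
  blk = proj₁ (pattern-seq-unfold q s)
  unfold : pattern-seq q s ≡ oneTo q ++ concat (map blk (downFrom q))
  unfold = proj₂ (pattern-seq-unfold q s)
  blk≗ : ∀ j → blk j ≡ replicate (mult s j) (suc j)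
  blk≗ j with j <? q
  ... | yes _ = refl
  ... | no _  = refl

lookup≡mult : ∀ {q} (s : Vec ℕ q) i → lookup s i ≡ mult s (toℕ i)
lookup≡mult {q} s i with toℕ i <? q
... | yes i<q = cong (lookup s) (sym (fromℕ<-toℕ i i<q))
... | no i≮q  = contradiction (toℕ<n i) i≮q

mult-tabulate : ∀ {q} (f : ℕ → ℕ) {j} → j < q → mult (Vec.tabulate {n = q} (f ∘ toℕ)) j ≡ f j
mult-tabulate {q} f {j} j<q with j <? q
... | yes j<q′ = trans (Vec.lookup∘tabulate (f ∘ toℕ) (fromℕ< j<q′)) (cong f (toℕ-fromℕ< j<q′))
... | no j≮q   = contradiction j<q j≮q

mult-injective : ∀ {q} {s s′ : Vec ℕ q} → (∀ {j} → j < q → mult s j ≡ mult s′ j) → s ≡ s′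
mult-injective {s = s} {s′} s≡s′ = begin
  s                       ≡⟨ Vec.tabulate∘lookup s ⟨
  Vec.tabulate (lookup s) ≡⟨ Vec.tabulate-cong (λ i → trans (lookup≡mult s i) (trans (s≡s′ (toℕ<n i)) (sym (lookup≡mult s′ i)))) ⟩
  Vec.tabulate (lookup s′) ≡⟨ Vec.tabulate∘lookup s′ ⟩
  s′                      ∎

oneTo-≤ : ∀ q → All (_≤ q) (oneTo q)
oneTo-≤ q = Allₚ.map⁺ (Allₚ.applyUpTo⁺₁ (λ i → i) q (λ i<q → i<q))

oneTo-positive : ∀ q → All (1 ≤_) (oneTo q)
oneTo-positive q = Allₚ.map⁺ (Allₚ.applyUpTo⁺₂ (λ i → i) q (λ _ → s≤s z≤n))

max-pattern-seq : ∀ {q} (s : Vec ℕ q) → max 0 (pattern-seq q s) ≡ q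
max-pattern-seq {q} s = trans (cong (max 0) (pattern-seq-blocks s)) (≤-antisym upper lower)
  where
  upper : max 0 (oneTo q ++ blocks (mult s) q) ≤ q
  upper = max≤v⁺ z≤n (Allₚ.++⁺ (oneTo-≤ q) (blocks-≤ (mult s) q))
  reached : ∀ q ys → q ≤ 0 ⊎ Any (q ≤_) (oneTo q ++ ys)
  reached zero    _ = inj₁ z≤n
  reached (suc q) _ = inj₂ (Any.++⁺ˡ (Any.map⁺ {f = suc} (Any.applyUpTo⁺ (λ i → i) {i = q} ≤-refl ≤-refl)))
  lower : q ≤ max 0 (oneTo q ++ blocks (mult s) q)
  lower = v≤max⁺ 0 _ (reached q _)

pattern-seq-injective : ∀ {q q′} (s : Vec ℕ q) (s′ : Vec ℕ q′) → pattern-seq q s ≡ pattern-seq q′ s′ →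
  Σ (q ≡ q′) (λ e → subst (Vec ℕ) e s ≡ s′)
pattern-seq-injective {q} s s′ eq with trans (sym (max-pattern-seq s)) (trans (cong (max 0) eq) (max-pattern-seq s′))
... | refl = refl , mult-injective (λ {j} j<q → begin
  mult s j                             ≡⟨ count-blocks (mult s) q j<q ⟨
  count (suc j) (blocks (mult s) q)    ≡⟨ cong (count (suc j)) blocks≡ ⟩
  count (suc j) (blocks (mult s′) q)   ≡⟨ count-blocks (mult s′) q j<q ⟩
  mult s′ j                            ∎)
  where
  blocks≡ : blocks (mult s) q ≡ blocks (mult s′) q
  blocks≡ = ++-cancelˡ (oneTo q) _ _ (trans (sym (pattern-seq-blocks s)) (trans eq (pattern-seq-blocks s′)))

weightedSum≡∑ : ∀ {q} (s : Vec ℕ q) → weightedSum q s ≡ ∑[ j < q ] (suc j * mult s j)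
weightedSum≡∑ {q} s = cong sum (begin
  map (λ i → suc (toℕ i) * lookup s i) (allFin q)   ≡⟨ map-tabulate (λ i → i) _ ⟩
  tabulate (λ i → suc (toℕ i) * lookup s i)         ≡⟨ tabulate-cong (λ i → cong (suc (toℕ i) *_) (lookup≡mult s i)) ⟩
  tabulate (λ i → suc (toℕ i) * mult s (toℕ i))     ≡⟨ tabulate-toℕ q (λ j → suc j * mult s j) ⟩
  applyUpTo (λ j → suc j * mult s j) q              ∎)

sum-pattern-seq : ∀ {q} (s : Vec ℕ q) → sum (pattern-seq q s) ≡ sum (oneTo q) + weightedSum q s
sum-pattern-seq {q} s = begin
  sum (pattern-seq q s)                              ≡⟨ cong sum (pattern-seq-blocks s) ⟩
  sum (oneTo q ++ blocks (mult s) q)                 ≡⟨ sum-++ (oneTo q) (blocks (mult s) q) ⟩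
  sum (oneTo q) + sum (blocks (mult s) q)            ≡⟨ cong (sum (oneTo q) +_) (trans (sum-blocks (mult s) q) (sym (weightedSum≡∑ s))) ⟩
  sum (oneTo q) + weightedSum q s                    ∎

sum-oneTo-*2 : ∀ q → sum (oneTo q) * 2 ≡ q * (q + 1)
sum-oneTo-*2 q = trans (cong (λ xs → sum xs * 2) (map-upTo suc q)) (gauss q)
  where
  gauss-step : ∀ q → q * (q + 1) + suc q * 2 ≡ suc q * (suc q + 1)
  gauss-step = solve-∀
  gauss : ∀ q → (∑[ j < q ] suc j) * 2 ≡ q * (q + 1)
  gauss zero    = refl
  gauss (suc q) = begin
    (∑[ j < suc q ] suc j) * 2              ≡⟨ cong (_* 2) (∑-init-last q suc) ⟩
    (∑[ j < q ] suc j + suc q) * 2          ≡⟨ *-distribʳ-+ 2 (∑[ j < q ] suc j) (suc q) ⟩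
    (∑[ j < q ] suc j) * 2 + suc q * 2      ≡⟨ cong (_+ suc q * 2) (gauss q) ⟩
    q * (q + 1) + suc q * 2                 ≡⟨ gauss-step q ⟩
    suc q * (suc q + 1)                     ∎

triangle : ∀ q → (q * (q + 1)) / 2 ≡ sum (oneTo q)
triangle q = trans (cong (_/ 2) (sym (sum-oneTo-*2 q))) (m*n/n≡m (sum (oneTo q)) 2)

-- Diagonal counts

module _ (h : ℕ → ℕ) where

  reaching : ℕ → ℕ → ℕ
  reaching k m = ∑[ j < m ] 𝟙 (k ≤? h j)

  diagCount : ℕ → ℕ
  diagCount k = reaching k k

  Saturated : ℕ → Set
  Saturated k = ∀ {j} → j < k → k ≤ h j

  saturated? : Decidable Saturated
  saturated? k = allUpTo? (λ j → k ≤? h j) k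

  saturated-≤ : ∀ {k m} → m ≤ k → Saturated k → Saturated m
  saturated-≤ m≤k sat j<m = ≤-trans m≤k (sat (<-≤-trans j<m m≤k))

  diagCount-saturated : ∀ {k} → Saturated k → diagCount k ≡ k
  diagCount-saturated {k} sat = trans (∑-cong k (λ j<k → 𝟙-yes (k ≤? h _) (sat j<k))) (∑-one k)

  reaching-hit : ∀ {k m} → k ≤ h m → reaching k (suc m) ≡ reaching k m + 1
  reaching-hit {k} {m} k≤h = trans (∑-init-last m (λ j → 𝟙 (k ≤? h j))) (cong (reaching k m +_) (𝟙-yes (k ≤? h m) k≤h))

  reaching-miss : ∀ {k m} → ¬ k ≤ h m → reaching k (suc m) ≡ reaching k m
  reaching-miss {k} {m} k≰h =
    trans (∑-init-last m (λ j → 𝟙 (k ≤? h j))) (trans (cong (reaching k m +_) (𝟙-no (k ≤? h m) k≰h)) (+-identityʳ _))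

  reaching-antitone : ∀ k m → reaching (suc k) m ≤ reaching k m
  reaching-antitone k m = ∑-mono m (λ j → 𝟙-mono (suc k ≤? h j) (k ≤? h j) <⇒≤)

  -- cover N j counts the k with j < k ≤ N and k ≤ h j: the share of row j in d_1 + ⋯ + d_N.
  cover : ℕ → ℕ → ℕ
  cover N j = h j ⊓ N ∸ j

  cover-step : ∀ N {j} → j ≤ N → cover (suc N) j ≡ 𝟙 (suc N ≤? h j) + cover N j
  cover-step N {j} j≤N with suc N ≤? h j
  ... | yes N<h = begin
    h j ⊓ suc N ∸ j     ≡⟨ cong (_∸ j) (m≥n⇒m⊓n≡n N<h) ⟩
    suc N ∸ j           ≡⟨ +-∸-assoc 1 j≤N ⟩
    suc (N ∸ j)         ≡⟨ cong (λ x → suc (x ∸ j)) (m≥n⇒m⊓n≡n (<⇒≤ N<h)) ⟨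
    suc (h j ⊓ N ∸ j)   ∎
  ... | no N≮h = cong (_∸ j) (trans (m≤n⇒m⊓n≡m (m≤n⇒m≤1+n h≤N)) (sym (m≤n⇒m⊓n≡m h≤N)))
    where
    h≤N : h j ≤ N
    h≤N = ≮⇒≥ N≮h

  ∑-diagCount : ∀ N → ∑[ k < N ] diagCount (suc k) ≡ ∑[ j < N ] cover N j
  ∑-diagCount zero    = refl
  ∑-diagCount (suc N) = begin
    ∑[ k < suc N ] diagCount (suc k)                          ≡⟨ ∑-init-last N (diagCount ∘ suc) ⟩
    ∑[ k < N ] diagCount (suc k) + diagCount (suc N)          ≡⟨ cong (_+ diagCount (suc N)) (trans (∑-diagCount N) last-cover) ⟩
    ∑[ j < suc N ] cover N j + diagCount (suc N)              ≡⟨ +-comm _ (diagCount (suc N)) ⟩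
    diagCount (suc N) + ∑[ j < suc N ] cover N j              ≡⟨ ∑-distrib-+ (suc N) (λ j → 𝟙 (suc N ≤? h j)) (cover N) ⟨
    ∑[ j < suc N ] (𝟙 (suc N ≤? h j) + cover N j)             ≡⟨ ∑-cong (suc N) (λ j<1+N → sym (cover-step N (≤-pred j<1+N))) ⟩
    ∑[ j < suc N ] cover (suc N) j                            ∎
    where
    last-cover : ∑[ j < N ] cover N j ≡ ∑[ j < suc N ] cover N j
    last-cover = sym (begin
      ∑[ j < suc N ] cover N j      ≡⟨ ∑-init-last N (cover N) ⟩
      ∑[ j < N ] cover N j + cover N N ≡⟨ cong (∑[ j < N ] cover N j +_) (m≤n⇒m∸n≡0 (m⊓n≤n (h N) N)) ⟩
      ∑[ j < N ] cover N j + 0      ≡⟨ +-identityʳ _ ⟩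
      ∑[ j < N ] cover N j          ∎)

  module _ (h-step : ∀ j → h (suc j) ≤ suc (h j)) where

    -- If some row j ≤ m misses k + 1, the last such row reaches exactly k, since h grows by at most 1
    -- per row; it makes up for row m + 1.
    reaching-step : ∀ k m → reaching (suc k) (suc m) ≤ reaching k m ⊎ (∀ {j} → j < suc m → suc k ≤ h j)
    reaching-step k zero with suc k ≤? h 0
    ... | yes k<h₀ = inj₂ λ { z<s → k<h₀ }
    ... | no _     = inj₁ z≤n
    reaching-step k (suc m) with suc k ≤? h (suc m)
    ... | no k≮h = inj₁ (≤-trans (≤-reflexive (reaching-miss k≮h)) (reaching-antitone k (suc m)))
    ... | yes k<h with reaching-step k m
    ...   | inj₂ sat = inj₂ (extend-< sat k<h)
    ...   | inj₁ le  =
      inj₁ (≤-trans (≤-reflexive (reaching-hit k<h)) (≤-trans (+-monoˡ-≤ 1 le) (≤-reflexive (sym (reaching-hit k≤h)))))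
      where
      k≤h : k ≤ h m
      k≤h = ≤-pred (≤-trans k<h (h-step m))

    diagCount-step : ∀ k → diagCount (suc k) ≤ diagCount k ⊎ Saturated (suc k)
    diagCount-step k = reaching-step k k

rise-then-fall : ∀ (f : ℕ → ℕ) q n → q ≤ n → (∀ {k} → k ≤ q → f k ≡ k) → (∀ {k} → q ≤ k → f (suc k) ≤ f k) →
  ∃[ ys ] applyUpTo (f ∘ suc) n ≡ oneTo q ++ ys × Linked _≥_ ys × All (_≤ q) ys
rise-then-fall f q n q≤n rise fall = tail , shape , Linkedₚ.applyUpTo⁺₂ _ (n ∸ q) tail-falls , Allₚ.applyUpTo⁺₂ _ (n ∸ q) tail-≤
  where
  tail : List ℕ
  tail = applyUpTo (λ j → f (suc (q + j))) (n ∸ q)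
  shape : applyUpTo (f ∘ suc) n ≡ oneTo q ++ tail
  shape = begin
    applyUpTo (f ∘ suc) n                                 ≡⟨ cong (applyUpTo (f ∘ suc)) (m+[n∸m]≡n q≤n) ⟨
    applyUpTo (f ∘ suc) (q + (n ∸ q))                     ≡⟨ applyUpTo-+ (f ∘ suc) q (n ∸ q) ⟩
    applyUpTo (f ∘ suc) q ++ tail                         ≡⟨ cong (_++ tail) (applyUpTo-cong q rise) ⟩
    applyUpTo suc q ++ tail                               ≡⟨ cong (_++ tail) (map-upTo suc q) ⟨
    oneTo q ++ tail                                       ∎
  falls : ∀ j → f (q + suc j) ≤ f (q + j)
  falls j = subst (λ x → f x ≤ f (q + j)) (sym (+-suc q j)) (fall (m≤m+n q j))
  bounded : ∀ j → f (q + j) ≤ q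
  bounded zero    = ≤-reflexive (trans (cong f (+-identityʳ q)) (rise ≤-refl))
  bounded (suc j) = ≤-trans (falls j) (bounded j)
  tail-falls : ∀ j → f (suc (q + suc j)) ≤ f (suc (q + j))
  tail-falls j = subst₂ (λ x y → f x ≤ f y) (+-suc q (suc j)) (+-suc q j) (falls (suc j))
  tail-≤ : ∀ j → f (suc (q + j)) ≤ q
  tail-≤ j = subst (λ x → f x ≤ q) (+-suc q j) (bounded (suc j))

-- Partitions

-- Rows are counted from 0: d_k counts the rows j < k with k ≤ row α j = α_{j+1} + j.
row : List ℕ → ℕ → ℕ
row α j = part α (suc j) + j

part-antitone : ∀ {α} → Linked _≥_ α → ∀ j → part α (suc (suc j)) ≤ part α (suc j)
part-antitone {[]}         _          _       = z≤n
part-antitone {_ ∷ []}     _          _       = z≤n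
part-antitone {_ ∷ _ ∷ _} (a≥b ∷ _)  zero    = a≥b
part-antitone {_ ∷ _ ∷ _} (_ ∷ lk)   (suc j) = part-antitone lk j

row-step : ∀ {α} → Linked _≥_ α → ∀ j → row α (suc j) ≤ suc (row α j)
row-step {α} lk j = ≤-trans (+-monoˡ-≤ (suc j) (part-antitone lk j)) (≤-reflexive (+-suc (part α (suc j)) j))

diag≡diagCount : ∀ α k → diag α k ≡ diagCount (row α) k
diag≡diagCount α k = begin
  length (filter P? (oneTo k))                 ≡⟨ length-filter≡sum-𝟙 P? (oneTo k) ⟩
  sum (map (𝟙 ∘ P?) (oneTo k))                 ≡⟨ cong sum (map-oneTo (𝟙 ∘ P?) k) ⟩
  ∑[ j < k ] 𝟙 (P? (suc j))                    ≡⟨ ∑-cong k (λ {j} _ → cong (λ x → 𝟙 (k ≤? x ∸ 1)) (+-suc (part α (suc j)) j)) ⟩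
  diagCount (row α) k                          ∎
  where
  P? : Decidable (λ i → k ≤ part α i + i ∸ 1)
  P? i = k ≤? part α i + i ∸ 1

row₀≤sum : ∀ α → row α 0 ≤ sum α
row₀≤sum []      = z≤n
row₀≤sum (a ∷ α) = ≤-trans (≤-reflexive (+-identityʳ a)) (m≤m+n a (sum α))

part-vanishes-or-fits : ∀ {α} → All (1 ≤_) α → ∀ j → part α (suc j) ≡ 0 ⊎ row α j ≤ sum α
part-vanishes-or-fits {[]}    _          _       = inj₁ refl
part-vanishes-or-fits {a ∷ α} _          zero    = inj₂ (row₀≤sum (a ∷ α))
part-vanishes-or-fits {a ∷ α} (a≥1 ∷ pos) (suc j) with part-vanishes-or-fits pos j
... | inj₁ vanishes = inj₁ vanishes
... | inj₂ fits     = inj₂ (≤-trans (≤-reflexive (+-suc (part α (suc j)) j)) (+-mono-≤ a≥1 fits))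

cover-row : ∀ {α} → All (1 ≤_) α → ∀ j → cover (row α) (sum α) j ≡ part α (suc j)
cover-row {α} pos j with part-vanishes-or-fits pos j
... | inj₁ vanishes = begin
  row α j ⊓ sum α ∸ j                ≡⟨ cong (λ a → (a + j) ⊓ sum α ∸ j) vanishes ⟩
  j ⊓ sum α ∸ j                      ≡⟨ m≤n⇒m∸n≡0 (m⊓n≤m j (sum α)) ⟩
  0                                  ≡⟨ vanishes ⟨
  part α (suc j)                     ∎
... | inj₂ fits = trans (cong (_∸ j) (m≤n⇒m⊓n≡m fits)) (m+n∸n≡m (part α (suc j)) j)

∑-part : ∀ α m → length α ≤ m → ∑[ j < m ] part α (suc j) ≡ sum α
∑-part []      zero    _         = refl
∑-part []      (suc m) _         = ∑-part [] m z≤n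
∑-part (a ∷ α) (suc m) (s≤s len) = cong (a +_) (∑-part α m len)

length≤sum : ∀ {α} → All (1 ≤_) α → length α ≤ sum α
length≤sum []          = z≤n
length≤sum (a≥1 ∷ pos) = +-mono-≤ a≥1 (length≤sum pos)

sum-δ : ∀ {n α} → IsPartition n α → sum (δ α) ≡ n
sum-δ {α = α} (_ , pos , refl) = begin
  sum (δ α)                                   ≡⟨ sum-dropTrailingZeros (map (diag α) (oneTo n)) ⟩
  sum (map (diag α) (oneTo n))                ≡⟨ cong sum (map-oneTo (diag α) n) ⟩
  ∑[ k < n ] diag α (suc k)                   ≡⟨ ∑-cong n (λ {k} _ → diag≡diagCount α (suc k)) ⟩
  ∑[ k < n ] diagCount (row α) (suc k)        ≡⟨ ∑-diagCount (row α) n ⟩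
  ∑[ j < n ] cover (row α) n j                ≡⟨ ∑-cong n (λ {j} _ → cover-row pos j) ⟩
  ∑[ j < n ] part α (suc j)                   ≡⟨ ∑-part α n (length≤sum pos) ⟩
  n                                           ∎
  where
  n : ℕ
  n = sum α

first-row-saturated : ∀ {α} → All (1 ≤_) α → 0 < sum α → Saturated (row α) 1
first-row-saturated {a ∷ _} (a≥1 ∷ _) _ z<s = ≤-trans a≥1 (m≤m+n a 0)

diag-profile : ∀ {n α} → IsPartition n α → 0 < n →
  ∃[ q ] 0 < q × q ≤ n × (∀ {k} → k ≤ q → diag α k ≡ k) × (∀ {k} → q ≤ k → diag α (suc k) ≤ diag α k)
diag-profile {α = α} (lk , pos , refl) n>0
  with boundary (saturated? (row α) ∘ suc) (first-row-saturated pos n>0) (sum α) (λ sat → 1+n≰n (≤-trans (sat z<s) (row₀≤sum α)))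
... | q , sat , unsat = suc q , z<s , ≤-trans (sat z<s) (row₀≤sum α) , rise , fall
  where
  rise : ∀ {k} → k ≤ suc q → diag α k ≡ k
  rise {k} k≤q = trans (diag≡diagCount α k) (diagCount-saturated (row α) (saturated-≤ (row α) k≤q sat))
  fall : ∀ {k} → suc q ≤ k → diag α (suc k) ≤ diag α k
  fall {k} q≤k with diagCount-step (row α) (row-step lk) k
  ... | inj₁ le   = subst₂ _≤_ (sym (diag≡diagCount α (suc k))) (sym (diag≡diagCount α k)) le
  ... | inj₂ sat′ = ⊥-elim (unsat (saturated-≤ (row α) (s≤s q≤k) sat′))

δ-shape : ∀ {n α} → IsPartition n α → 0 < n → ∃₂ λ q (s : Vec ℕ q) → 0 < q × δ α ≡ pattern-seq q s
δ-shape {α = α} isPartition@(_ , _ , refl) n>0 with diag-profile isPartition n>0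
... | q , q>0 , q≤n , rise , fall with rise-then-fall (diag α) q (sum α) q≤n rise fall
...   | ys , shape , lk , ys≤q = q , s , q>0 , (begin
  δ α                                                             ≡⟨ cong dropTrailingZeros (trans (map-oneTo (diag α) (sum α)) shape) ⟩
  dropTrailingZeros (oneTo q ++ ys)                               ≡⟨ cong (λ ys → dropTrailingZeros (oneTo q ++ ys)) (blocks-decomposition q lk ys≤q) ⟩
  dropTrailingZeros (oneTo q ++ blocks f q ++ replicate z 0)      ≡⟨ cong dropTrailingZeros (++-assoc (oneTo q) (blocks f q) _) ⟨
  dropTrailingZeros ((oneTo q ++ blocks f q) ++ replicate z 0)    ≡⟨ dropTrailingZeros-++-zeros (oneTo q ++ blocks f q) z ⟩
  dropTrailingZeros (oneTo q ++ blocks f q)                       ≡⟨ dropTrailingZeros-positive (Allₚ.++⁺ (oneTo-positive q) (blocks-positive f q)) ⟩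
  oneTo q ++ blocks f q                                           ≡⟨ cong (oneTo q ++_) (blocks-cong q (sym ∘ mult-tabulate f)) ⟩
  oneTo q ++ blocks (mult s) q                                    ≡⟨ pattern-seq-blocks s ⟨
  pattern-seq q s                                                 ∎)
  where
  f : ℕ → ℕ
  f j = count (suc j) ys
  z : ℕ
  z = count 0 ys
  s : Vec ℕ q
  s = Vec.tabulate (f ∘ toℕ)

corollary2p2 : (n : ℕ) → 0 < n → (α : List ℕ) → IsPartition n α →
    Σ ℕ (λ q → Σ (Vec ℕ q) (λ s →
      (0 < q) × (δ α ≡ pattern-seq q s)
      × ((q' : ℕ) (s' : Vec ℕ q') → 0 < q' → δ α ≡ pattern-seq q' s' →
           Σ (q ≡ q') (λ e → subst (Vec ℕ) e s ≡ s'))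
      × ((q * (q + 1)) / 2 + weightedSum q s ≡ n)))
corollary2p2 n n>0 α isPartition with δ-shape isPartition n>0
... | q , s , q>0 , δ≡ = q , s , q>0 , δ≡ , unique , weight
  where
  unique : (q′ : ℕ) (s′ : Vec ℕ q′) → 0 < q′ → δ α ≡ pattern-seq q′ s′ →
    Σ (q ≡ q′) (λ e → subst (Vec ℕ) e s ≡ s′)
  unique q′ s′ _ δ≡′ = pattern-seq-injective s s′ (trans (sym δ≡) δ≡′)
  weight : (q * (q + 1)) / 2 + weightedSum q s ≡ n
  weight = begin
    (q * (q + 1)) / 2 + weightedSum q s   ≡⟨ cong (_+ weightedSum q s) (triangle q) ⟩
    sum (oneTo q) + weightedSum q s       ≡⟨ sum-pattern-seq s ⟨
    sum (pattern-seq q s)                 ≡⟨ cong sum δ≡ ⟨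
    sum (δ α)                             ≡⟨ sum-δ isPartition ⟩
    n                                     ∎
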